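{- Consider keys $\{1,\dots,15\}$ with weights $p_1=p_{15}=7$, $p_k=5$ for even $k$, and $p_k=0$ for odd $k\in\{3,5,\dots,13\}$. For $1\le\ell\le14$ let $I_\ell=\{1,\dots,\ell\}$ and $q_\ell=1+\lfloor\ell/2\rfloor$ (the number of positive-weight keys in $I_\ell$). Let $\ell\le14$ and $h'$ be such that $q_\ell-h'=5$, and let $T'$ be an optimal tree for the subproblem $(I_\ell,h')$. Then $T'$ has weight $27$ and cost $69$.
   Context: A two-way-comparison search tree for a query set $S$ is a rooted binary tree whose internal nodes each have two children and are labeled by a key and an operator (equality or less-than), with $|S|$ leaves labeled by distinct elements of $S$; the search for $v$ follows comparison outcomes from the root, and the tree is correct if the search for each $v\in S$ ends at the leaf labeled $v$. Its cost is $\sum_{v\in S}p_v\,\mathrm{depth}(v)$ and its weight is $\sum_{v\in S}p_v$. An optimal tree for the subproblem $(I,h)$ is a correct tree of minimum cost among all correct trees for query sets $I\setminus H$ with $H\subseteq I$, $|H|=h$. -}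

module Defs where

open import Data.Nat using (ℕ; zero; suc; _+_; _*_; _≤_; _/_; _≡ᵇ_; _<ᵇ_)
open import Data.Bool using (Bool; true; false; if_then_else_)
open import Data.List using (List; []; _∷_; _++_; map; length; applyUpTo)
open import Data.Nat.ListAction using (sum)
open import Data.List.Membership.Propositional using (_∈_)
open import Data.List.Relation.Unary.All using (All)
open import Data.List.Relation.Unary.Unique.Propositional using (Unique)
open import Data.Product using (_×_)
open import Relation.Binary.PropositionalEquality using (_≡_)

data Op : Set where
  eqOp : Op
  ltOp : Op

test : Op → ℕ → ℕ → Bool
test eqOp v k = v ≡ᵇ k
test ltOp v k = v <ᵇ k

data Tree : Set where
  leaf : ℕ → Tree
  node : Op → ℕ → Tree → Tree → Tree

leaves : Tree → List ℕ
leaves (leaf v) = v ∷ []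
leaves (node _ _ l r) = leaves l ++ leaves r

search : ℕ → Tree → ℕ
search v (leaf u) = u
search v (node op k l r) = if test op v k then search v l else search v r

depth : ℕ → Tree → ℕ
depth v (leaf u) = 0
depth v (node op k l r) = suc (if test op v k then depth v l else depth v r)

Correct : List ℕ → Tree → Set
Correct S T =
  Unique (leaves T) × All (_∈ S) (leaves T) × length (leaves T) ≡ length S
  × (∀ v → v ∈ S → search v T ≡ v)

p : ℕ → ℕ
p 1 = 7
p 2 = 5
p 3 = 0
p 4 = 5
p 5 = 0
p 6 = 5
p 7 = 0
p 8 = 5
p 9 = 0
p 10 = 5
p 11 = 0
p 12 = 5
p 13 = 0
p 14 = 5
p 15 = 7
p _ = 0

weight : List ℕ → ℕ
weight S = sum (map p S)

cost : List ℕ → Tree → ℕ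
cost S T = sum (map (λ v → p v * depth v T) S)

I : ℕ → List ℕ
I ℓ = applyUpTo suc ℓ

q : ℕ → ℕ
q ℓ = 1 + ℓ / 2

-- S = J \ H for some H ⊆ J with |H| = h  (J duplicate-free):
-- S is a duplicate-free sublist-set of J with |S| + h = |J|.
Admissible : List ℕ → ℕ → List ℕ → Set
Admissible J h S = Unique S × All (_∈ J) S × length S + h ≡ length J

Optimal : List ℕ → ℕ → List ℕ → Tree → Set
Optimal J h S T =
  Admissible J h S × Correct S T
  × (∀ S′ T′ → Admissible J h S′ → Correct S′ T′ → cost S T ≤ cost S′ T′)

{-# OPTIONS --safe #-}
module Submission where

-- Every correct tree costs at least F (p-weights of its keys) for any function F on weight
-- sequences that vanishes on sequences of length ≤ 1 and satisfies
--   F W ≤ Σ W + F A + F B   for every splitting W = A ++ B   (a less-than test on increasing keys),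
--   F W ≤ Σ W + F V         for every V deleting one entry of W (an equality test):
-- each key pays its weight once at the root, and the two subtrees locate the two parts.
-- A tabulated such F is checked by evaluation.  On every selection of ℓ − h keys of I_ℓ it is
-- at least 69, and at least 70 unless the selection has weight 27; explicit trees of cost 69
-- for admissible query sets show that optimal trees cost exactly 69.

open import Defs
open import Data.Nat using (ℕ; zero; suc; _+_; _*_; _∸_; _≤_; _<_; _≡ᵇ_; _<ᵇ_; _≤ᵇ_; z≤n; s≤s; _≟_)
open import Data.Bool using (Bool; true; false; T; not; _∧_; _∨_)
open import Data.Bool.ListAction using (all)
open import Data.Bool.Properties using (T-∧; T-∨; T-≡; T?; ¬-not)
open import Data.List using (List; []; _∷_; [_]; _++_; map; length; filter; filterᵇ)
open import Data.List.Membership.DecPropositional _≟_ using (_∈?_)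
open import Data.List.Membership.Propositional using (_∈_)
open import Data.List.Membership.Propositional.Properties using (∈-filter⁺; ∈-filter⁻; ∈-map⁺; ∈-++⁺ˡ; ∈-++⁺ʳ)
open import Data.List.Membership.Propositional.Properties.WithK using (unique∧set⇒bag)
open import Data.List.Properties using (length-applyUpTo; map-++; ++-assoc; ++-identityʳ; filter-all; filter-none)
open import Data.List.Relation.Binary.BagAndSetEquality using (∼bag⇒↭)
open import Data.List.Relation.Binary.Permutation.Propositional using (_↭_)
open import Data.List.Relation.Binary.Permutation.Propositional.Properties using (map⁺; ↭-length)
open import Data.List.Relation.Binary.Sublist.Propositional using (_⊆_; []; _∷_; _∷ʳ_)
open import Data.List.Relation.Binary.Sublist.Propositional.Properties using (filter-⊆)
open import Data.List.Relation.Unary.All as All using (All; []; _∷_; all?)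
open import Data.List.Relation.Unary.All.Properties using (all⁺)
open import Data.List.Relation.Unary.AllPairs as AllPairs using (AllPairs; []; _∷_)
open import Data.List.Relation.Unary.AllPairs.Properties using (filter⁺; applyUpTo⁺₁)
open import Data.List.Relation.Unary.Any using (here; there)
open import Data.List.Relation.Unary.Unique.DecPropositional _≟_ using (unique?)
open import Data.List.Relation.Unary.Unique.Propositional using (Unique)
open import Data.Nat.ListAction using (sum)
open import Data.Nat.ListAction.Properties using (sum-↭)
open import Data.Nat.Properties
open import Data.Nat.Tactic.RingSolver using (solve-∀)
open import Data.Product as Product using (_×_; _,_; proj₁; proj₂; ∃₂)
open import Data.Sum as Sum using (_⊎_; inj₁; inj₂)
open import Function using (_∘_; id; Equivalence)
open import Function.Bundles using (mk⇔)
open import Relation.Binary.PropositionalEquality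
  using (_≡_; _≢_; refl; sym; trans; cong; cong₂; subst; module ≡-Reasoning)
open import Relation.Nullary using (Dec; contradiction)
open import Relation.Nullary.Decidable using (map′; _×-dec_; True; toWitness)

Locates : List ℕ → Tree → Set
Locates L t = ∀ v → v ∈ L → search v t ≡ v

module _ (op : Op) (k : ℕ) (l r : Tree) {L : List ℕ} (loc : Locates L (node op k l r)) where

  locates-left : Locates (filterᵇ (λ v → test op v k) L) l
  locates-left v v∈ with ∈-filter⁻ (T? ∘ (λ u → test op u k)) v∈
  ... | v∈L , goes-left with test op v k | loc v v∈L
  ...   | true | found = found

  locates-right : Locates (filterᵇ (λ v → not (test op v k)) L) r
  locates-right v v∈ with ∈-filter⁻ (T? ∘ (λ u → not (test op u k))) v∈
  ... | v∈L , goes-right with test op v k | loc v v∈L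
  ...   | false | found = found

cost-node : ∀ op k l r L → cost L (node op k l r) ≡
  weight L + cost (filterᵇ (λ v → test op v k) L) l + cost (filterᵇ (λ v → not (test op v k)) L) r
cost-node op k l r [] = refl
cost-node op k l r (x ∷ L) with test op x k
... | true  = trans (cong (p x * suc (depth x l) +_) (cost-node op k l r L))
                    (charge-left (p x) (depth x l) (weight L) _ _)
  where
  charge-left : ∀ a d w c e → a * suc d + (w + c + e) ≡ a + w + (a * d + c) + e
  charge-left = solve-∀
... | false = trans (cong (p x * suc (depth x r) +_) (cost-node op k l r L))
                    (charge-right (p x) (depth x r) (weight L) _ _)
  where
  charge-right : ∀ a d w c e → a * suc d + (w + c + e) ≡ a + w + c + (a * d + e)
  charge-right = solve-∀

≮ᵇ-mono : ∀ {x y} k → x ≤ y → (x <ᵇ k) ≡ false → (y <ᵇ k) ≡ false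
≮ᵇ-mono {x} {y} k x≤y x≮k =
  ¬-not (λ y<k → subst T x≮k (<⇒<ᵇ (≤-<-trans x≤y (<ᵇ⇒< y k (Equivalence.from T-≡ y<k)))))

filter-<-++ : ∀ k {L} → AllPairs _<_ L →
  filterᵇ (_<ᵇ k) L ++ filterᵇ (λ v → not (v <ᵇ k)) L ≡ L
filter-<-++ k [] = refl
filter-<-++ k {x ∷ L} (x<L ∷ increasing) with x <ᵇ k in x≮k
... | true  = cong (x ∷_) (filter-<-++ k increasing)
... | false = cong₂ _++_ (filter-none (T? ∘ (_<ᵇ k)) (All.map (λ x<y → subst T (≮k x<y)) x<L))
                          (cong (x ∷_) (filter-all (T? ∘ (λ v → not (v <ᵇ k))) (All.map ≥k x<L)))
  where
  ≮k : ∀ {y} → x < y → (y <ᵇ k) ≡ false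
  ≮k x<y = ≮ᵇ-mono k (<⇒≤ x<y) x≮k
  ≥k : ∀ {y} → x < y → T (not (y <ᵇ k))
  ≥k x<y = subst (T ∘ not) (sym (≮k x<y)) _

≢⇒not-≡ᵇ : ∀ {x k} → x ≢ k → T (not (x ≡ᵇ k))
≢⇒not-≡ᵇ {x} {k} x≢k with x ≡ᵇ k in x≡k
... | true  = contradiction (≡ᵇ⇒≡ x k (Equivalence.from T-≡ x≡k)) x≢k
... | false = _

filter-≢ : ∀ k {L} → Unique L →
  filterᵇ (λ v → not (v ≡ᵇ k)) L ≡ L ⊎
  ∃₂ λ C D → L ≡ C ++ k ∷ D × filterᵇ (λ v → not (v ≡ᵇ k)) L ≡ C ++ D
filter-≢ k [] = inj₁ refl
filter-≢ k {x ∷ L} (x∉L ∷ unique) with x ≡ᵇ k in x≡k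
... | true with refl ← ≡ᵇ⇒≡ x k (Equivalence.from T-≡ x≡k) =
  inj₂ ([] , L , refl , filter-all (T? ∘ (λ v → not (v ≡ᵇ x))) (All.map (λ x≢y → ≢⇒not-≡ᵇ (x≢y ∘ sym)) x∉L))
... | false = Sum.map (cong (x ∷_)) (λ (C , D , L≡ , filtered) → x ∷ C , D , cong (x ∷_) L≡ , cong (x ∷_) filtered)
                      (filter-≢ k unique)

record LowerBound (F : List ℕ → ℕ) : Set where
  field
    empty     : F [] ≡ 0
    singleton : ∀ w → F (w ∷ []) ≡ 0
    split     : ∀ A B → F (A ++ B) ≤ sum (A ++ B) + F A + F B
    delete    : ∀ A w B → F (A ++ w ∷ B) ≤ sum (A ++ w ∷ B) + F (A ++ B)

module _ {F : List ℕ → ℕ} (lowerBound : LowerBound F) where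
  open LowerBound lowerBound

  split-keys : ∀ A B → F (map p (A ++ B)) ≤ weight (A ++ B) + F (map p A) + F (map p B)
  split-keys A B rewrite map-++ p A B = split (map p A) (map p B)

  delete-key : ∀ A k B → F (map p (A ++ k ∷ B)) ≤ weight (A ++ k ∷ B) + F (map p (A ++ B))
  delete-key A k B rewrite map-++ p A (k ∷ B) | map-++ p A B = delete (map p A) (p k) (map p B)

  test-bound : ∀ op k {L} → AllPairs _<_ L →
    F (map p L) ≤ weight L + F (map p (filterᵇ (λ v → test op v k) L))
                           + F (map p (filterᵇ (λ v → not (test op v k)) L))
  test-bound ltOp k {L} increasing
    with split-keys (filterᵇ (_<ᵇ k) L) (filterᵇ (λ v → not (v <ᵇ k)) L)
  ... | splitting rewrite filter-<-++ k increasing = splitting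
  test-bound eqOp k {L} increasing with filter-≢ k (AllPairs.map <⇒≢ increasing)
  ... | inj₁ unchanged rewrite unchanged = m≤n+m _ _
  ... | inj₂ (C , D , refl , removed) rewrite removed =
    ≤-trans (delete-key C k D) (+-monoˡ-≤ (F (map p (C ++ D))) (m≤m+n (weight (C ++ k ∷ D)) _))

  cost-lowerBound : ∀ t {L} → AllPairs _<_ L → Locates L t → F (map p L) ≤ cost L t
  cost-lowerBound (leaf _) {[]} _ _ = ≤-reflexive empty
  cost-lowerBound (leaf _) {x ∷ []} _ _ = ≤-trans (≤-reflexive (singleton (p x))) z≤n
  cost-lowerBound (leaf _) {x ∷ y ∷ L} ((x<y ∷ _) ∷ _) loc =
    contradiction (trans (sym (loc x (here refl))) (loc y (there (here refl)))) (<⇒≢ x<y)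
  cost-lowerBound (node op k l r) {L} increasing loc = begin
    F (map p L)                                       ≤⟨ test-bound op k increasing ⟩
    weight L + F (map p Lₗ) + F (map p Lᵣ)            ≤⟨ +-mono-≤ (+-monoʳ-≤ (weight L) left) right ⟩
    weight L + cost Lₗ l + cost Lᵣ r                  ≡⟨ cost-node op k l r L ⟨
    cost L (node op k l r)                            ∎
    where
    open ≤-Reasoning
    Lₗ = filterᵇ (λ v → test op v k) L
    Lᵣ = filterᵇ (λ v → not (test op v k)) L
    left : F (map p Lₗ) ≤ cost Lₗ l
    left = cost-lowerBound l (filter⁺ (T? ∘ (λ v → test op v k)) increasing)
                             (locates-left op k l r loc)
    right : F (map p Lᵣ) ≤ cost Lᵣ r
    right = cost-lowerBound r (filter⁺ (T? ∘ (λ v → not (test op v k))) increasing)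
                              (locates-right op k l r loc)

module _ {A : Set} where

  splits : List A → List (List A × List A)
  splits []       = ([] , []) ∷ []
  splits (x ∷ xs) = ([] , x ∷ xs) ∷ map (Product.map₁ (x ∷_)) (splits xs)

  deletions : List A → List (List A)
  deletions []       = []
  deletions (x ∷ xs) = xs ∷ map (x ∷_) (deletions xs)

  ∈-splits : ∀ xs ys → (xs , ys) ∈ splits (xs ++ ys)
  ∈-splits []       []       = here refl
  ∈-splits []       (y ∷ ys) = here refl
  ∈-splits (x ∷ xs) ys       = there (∈-map⁺ (Product.map₁ (x ∷_)) (∈-splits xs ys))

  ∈-deletions : ∀ xs y ys → xs ++ ys ∈ deletions (xs ++ y ∷ ys)
  ∈-deletions []       y ys = here refl
  ∈-deletions (x ∷ xs) y ys = there (∈-map⁺ (x ∷_) (∈-deletions xs y ys))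

module _ (F : List ℕ → ℕ) where

  splitBounded : List ℕ → List ℕ × List ℕ → Bool
  splitBounded W (A , B) = F W ≤ᵇ sum W + F A + F B

  deletionBounded : List ℕ → List ℕ → Bool
  deletionBounded W V = F W ≤ᵇ sum W + F V

  certified : List ℕ → Bool
  certified W = (F W ≡ᵇ 0) ∨ ((2 ≤ᵇ length W) ∧ (all (splitBounded W) (splits W)
                                                ∧ all (deletionBounded W) (deletions W)))

  certified-zero : ∀ {W} → F W ≡ 0 → T (certified W)
  certified-zero {W} F≡0 = Equivalence.from T-∨ (inj₁ (≡⇒≡ᵇ (F W) 0 F≡0))

  Bounded : List ℕ → Set
  Bounded W = 2 ≤ length W × All (T ∘ splitBounded W) (splits W) × All (T ∘ deletionBounded W) (deletions W)

  certified-cases : ∀ W → T (certified W) → F W ≡ 0 ⊎ Bounded W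
  certified-cases W ok with Equivalence.to T-∨ ok
  ... | inj₁ F≡0 = inj₁ (≡ᵇ⇒≡ (F W) 0 F≡0)
  ... | inj₂ rest with Equivalence.to T-∧ rest
  ...   | long , bounded with Equivalence.to T-∧ bounded
  ...     | split-ok , delete-ok =
    inj₂ (≤ᵇ⇒≤ 2 (length W) long , all⁺ (splitBounded W) (splits W) split-ok
                                 , all⁺ (deletionBounded W) (deletions W) delete-ok)

  certified⇒lowerBound : (∀ W → T (certified W)) → LowerBound F
  certified⇒lowerBound ok = record
    { empty     = short [] z≤n
    ; singleton = λ w → short (w ∷ []) ≤-refl
    ; split     = λ A B → bounded (A ++ B) λ (_ , splitting , _) →
                    ≤ᵇ⇒≤ _ _ (All.lookup splitting (∈-splits A B))
    ; delete    = λ A w B → bounded (A ++ w ∷ B) λ (_ , _ , deleting) →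
                    ≤ᵇ⇒≤ _ _ (All.lookup deleting (∈-deletions A w B))
    }
    where
    short : ∀ W → length W ≤ 1 → F W ≡ 0
    short W ≤1 with certified-cases W (ok W)
    ... | inj₁ F≡0 = F≡0
    ... | inj₂ (≥2 , _) = contradiction ≤1 (<⇒≱ ≥2)
    bounded : ∀ W {n} → (Bounded W → F W ≤ n) → F W ≤ n
    bounded W from-bounds with certified-cases W (ok W)
    ... | inj₁ F≡0 = ≤-trans (≤-reflexive F≡0) z≤n
    ... | inj₂ conditions = from-bounds conditions

-- A table of values on weight sequences over the alphabet {0, 5, 7} of weights of p;
-- `look` gives 0 off the table.
data Trie : Set where
  ∅      : Trie
  branch : ℕ → (t₀ t₅ t₇ : Trie) → Trie

child : ℕ → Trie → Trie → Trie → Trie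
child 0 t₀ t₅ t₇ = t₀
child 5 t₀ t₅ t₇ = t₅
child 7 t₀ t₅ t₇ = t₇
child _ t₀ t₅ t₇ = ∅

look : Trie → List ℕ → ℕ
look ∅                   _       = 0
look (branch v _ _ _)    []      = v
look (branch _ t₀ t₅ t₇) (x ∷ W) = look (child x t₀ t₅ t₇) W

module _ (ok : List ℕ → Bool) where

  everywhere : Trie → List ℕ → Bool
  everywhere ∅                   pre = true
  everywhere (branch _ t₀ t₅ t₇) pre =
    ok pre ∧ (everywhere t₀ (pre ++ [ 0 ]) ∧ (everywhere t₅ (pre ++ [ 5 ]) ∧ everywhere t₇ (pre ++ [ 7 ])))

  descend : ∀ {pre} x W {n} → n ≡ 0 ⊎ T (ok ((pre ++ [ x ]) ++ W)) → n ≡ 0 ⊎ T (ok (pre ++ x ∷ W))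
  descend {pre} x W = Sum.map₂ (subst (T ∘ ok) (++-assoc pre [ x ] W))

  everywhere-sound : ∀ t pre → T (everywhere t pre) → ∀ W → look t W ≡ 0 ⊎ T (ok (pre ++ W))
  everywhere-sound ∅ _ _ _ = inj₁ refl
  everywhere-sound (branch _ t₀ t₅ t₇) pre checked W
    with ok-pre , rest ← Equivalence.to (T-∧ {ok pre}) checked
    with checked₀ , rest′ ← Equivalence.to (T-∧ {everywhere t₀ (pre ++ [ 0 ])}) rest
    with checked₅ , checked₇ ← Equivalence.to (T-∧ {everywhere t₅ (pre ++ [ 5 ])}) rest′
    with W
  ... | []    = inj₂ (subst (T ∘ ok) (sym (++-identityʳ pre)) ok-pre)
  ... | 0 ∷ V = descend 0 V (everywhere-sound t₀ _ checked₀ V)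
  ... | 5 ∷ V = descend 5 V (everywhere-sound t₅ _ checked₅ V)
  ... | 7 ∷ V = descend 7 V (everywhere-sound t₇ _ checked₇ V)
  ... | 1 ∷ _ = inj₁ refl
  ... | 2 ∷ _ = inj₁ refl
  ... | 3 ∷ _ = inj₁ refl
  ... | 4 ∷ _ = inj₁ refl
  ... | 6 ∷ _ = inj₁ refl
  ... | suc (suc (suc (suc (suc (suc (suc (suc _))))))) ∷ _ = inj₁ refl

bounds : Trie
bounds =
  (branch 0 (branch 0 (branch 0 (branch 0 (branch 0 (branch 0 (branch 0 ∅ (branch 5 ∅ ∅ ∅) ∅) (branch 5
  (branch 5 ∅ (branch 15 ∅ ∅ ∅) ∅) (branch 15 ∅ ∅ ∅) ∅) ∅) (branch 5 (branch 5 (branch 5 ∅ (branch 15 ∅ ∅ ∅)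
  ∅) (branch 15 (branch 15 ∅ (branch 30 ∅ ∅ ∅) ∅) (branch 30 ∅ ∅ ∅) ∅) ∅) (branch 15 (branch 15 ∅ (branch 30
  ∅ ∅ ∅) ∅) (branch 30 ∅ ∅ ∅) ∅) ∅) ∅) (branch 5 (branch 5 (branch 5 (branch 5 ∅ (branch 15 ∅ ∅ ∅) ∅) (branch
  15 (branch 15 ∅ (branch 30 ∅ ∅ ∅) ∅) (branch 30 ∅ ∅ ∅) ∅) ∅) (branch 15 (branch 15 (branch 15 ∅ (branch 30
  ∅ ∅ ∅) ∅) (branch 30 (branch 30 ∅ (branch 50 ∅ ∅ ∅) ∅) (branch 45 ∅ ∅ ∅) ∅) ∅) (branch 30 (branch 30 ∅
  (branch 50 ∅ ∅ ∅) ∅) (branch 45 ∅ ∅ ∅) ∅) ∅) ∅) (branch 15 (branch 15 (branch 15 ∅ (branch 30 ∅ ∅ ∅) ∅)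
  (branch 30 (branch 30 ∅ (branch 50 ∅ ∅ ∅) ∅) (branch 45 ∅ ∅ ∅) ∅) ∅) (branch 30 (branch 30 ∅ (branch 50 ∅ ∅
  ∅) ∅) (branch 45 ∅ ∅ ∅) ∅) ∅) ∅) ∅) (branch 5 (branch 5 (branch 5 (branch 5 (branch 5 ∅ (branch 15 ∅ ∅ ∅)
  ∅) (branch 15 (branch 15 ∅ (branch 30 ∅ ∅ ∅) ∅) (branch 30 ∅ ∅ ∅) ∅) ∅) (branch 15 (branch 15 (branch 15 ∅
  (branch 30 ∅ ∅ ∅) ∅) (branch 30 (branch 30 ∅ (branch 50 ∅ ∅ ∅) ∅) (branch 45 ∅ ∅ ∅) ∅) ∅) (branch 30
  (branch 30 ∅ (branch 50 ∅ ∅ ∅) ∅) (branch 45 ∅ ∅ ∅) ∅) ∅) ∅) (branch 15 (branch 15 (branch 15 (branch 15 ∅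
  (branch 30 ∅ ∅ ∅) ∅) (branch 30 (branch 30 ∅ (branch 50 ∅ ∅ ∅) ∅) (branch 45 ∅ ∅ ∅) ∅) ∅) (branch 30
  (branch 30 (branch 30 ∅ (branch 50 ∅ ∅ ∅) ∅) (branch 50 (branch 50 ∅ (branch 70 ∅ ∅ ∅) ∅) (branch 65 ∅ ∅ ∅)
  ∅) ∅) (branch 45 (branch 50 ∅ (branch 70 ∅ ∅ ∅) ∅) (branch 65 ∅ ∅ ∅) ∅) ∅) ∅) (branch 30 (branch 30 (branch
  30 ∅ (branch 50 ∅ ∅ ∅) ∅) (branch 50 (branch 50 ∅ (branch 70 ∅ ∅ ∅) ∅) (branch 65 ∅ ∅ ∅) ∅) ∅) (branch 45
  (branch 50 ∅ (branch 70 ∅ ∅ ∅) ∅) (branch 65 ∅ ∅ ∅) ∅) ∅) ∅) ∅) (branch 15 (branch 15 (branch 15 (branch 15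
  ∅ (branch 30 ∅ ∅ ∅) ∅) (branch 30 (branch 30 ∅ (branch 50 ∅ ∅ ∅) ∅) (branch 45 ∅ ∅ ∅) ∅) ∅) (branch 30
  (branch 30 (branch 30 ∅ (branch 50 ∅ ∅ ∅) ∅) (branch 50 (branch 50 ∅ (branch 70 ∅ ∅ ∅) ∅) (branch 65 ∅ ∅ ∅)
  ∅) ∅) (branch 45 (branch 50 ∅ (branch 70 ∅ ∅ ∅) ∅) (branch 65 ∅ ∅ ∅) ∅) ∅) ∅) (branch 30 (branch 30 (branch
  30 ∅ (branch 50 ∅ ∅ ∅) ∅) (branch 50 (branch 50 ∅ (branch 70 ∅ ∅ ∅) ∅) (branch 65 ∅ ∅ ∅) ∅) ∅) (branch 45
  (branch 50 ∅ (branch 70 ∅ ∅ ∅) ∅) (branch 65 ∅ ∅ ∅) ∅) ∅) ∅) ∅) ∅) (branch 5 (branch 5 (branch 5 (branch 5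
  (branch 5 (branch 5 ∅ (branch 15 ∅ ∅ ∅) ∅) (branch 15 (branch 15 ∅ (branch 30 ∅ ∅ ∅) ∅) (branch 30 ∅ ∅ ∅)
  ∅) ∅) (branch 15 (branch 15 (branch 15 ∅ (branch 30 ∅ ∅ ∅) ∅) (branch 30 (branch 30 ∅ (branch 50 ∅ ∅ ∅) ∅)
  (branch 45 ∅ ∅ ∅) ∅) ∅) (branch 30 (branch 30 ∅ (branch 50 ∅ ∅ ∅) ∅) (branch 45 ∅ ∅ ∅) ∅) ∅) ∅) (branch 15
  (branch 15 (branch 15 (branch 15 ∅ (branch 30 ∅ ∅ ∅) ∅) (branch 30 (branch 30 ∅ (branch 50 ∅ ∅ ∅) ∅)
  (branch 45 ∅ ∅ ∅) ∅) ∅) (branch 30 (branch 30 (branch 30 ∅ (branch 50 ∅ ∅ ∅) ∅) (branch 50 (branch 50 ∅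
  (branch 70 ∅ ∅ ∅) ∅) (branch 65 ∅ ∅ ∅) ∅) ∅) (branch 45 (branch 50 ∅ (branch 70 ∅ ∅ ∅) ∅) (branch 65 ∅ ∅ ∅)
  ∅) ∅) ∅) (branch 30 (branch 30 (branch 30 ∅ (branch 50 ∅ ∅ ∅) ∅) (branch 50 (branch 50 ∅ (branch 70 ∅ ∅ ∅)
  ∅) (branch 65 ∅ ∅ ∅) ∅) ∅) (branch 45 (branch 50 ∅ (branch 70 ∅ ∅ ∅) ∅) (branch 65 ∅ ∅ ∅) ∅) ∅) ∅) ∅)
  (branch 15 (branch 15 (branch 15 (branch 15 (branch 15 ∅ (branch 30 ∅ ∅ ∅) ∅) (branch 30 (branch 30 ∅
  (branch 50 ∅ ∅ ∅) ∅) (branch 45 ∅ ∅ ∅) ∅) ∅) (branch 30 (branch 30 (branch 30 ∅ (branch 50 ∅ ∅ ∅) ∅)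
  (branch 50 (branch 50 ∅ (branch 70 ∅ ∅ ∅) ∅) (branch 65 ∅ ∅ ∅) ∅) ∅) (branch 45 (branch 50 ∅ (branch 70 ∅ ∅
  ∅) ∅) (branch 65 ∅ ∅ ∅) ∅) ∅) ∅) (branch 30 (branch 30 (branch 30 (branch 30 ∅ (branch 50 ∅ ∅ ∅) ∅) (branch
  50 (branch 50 ∅ (branch 70 ∅ ∅ ∅) ∅) (branch 65 ∅ ∅ ∅) ∅) ∅) (branch 50 (branch 50 (branch 50 ∅ (branch 70
  ∅ ∅ ∅) ∅) (branch 70 (branch 70 ∅ (branch 90 ∅ ∅ ∅) ∅) (branch 90 ∅ ∅ ∅) ∅) ∅) (branch 65 (branch 70 ∅
  (branch 90 ∅ ∅ ∅) ∅) (branch 85 ∅ ∅ ∅) ∅) ∅) ∅) (branch 45 (branch 50 (branch 50 ∅ (branch 70 ∅ ∅ ∅) ∅)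
  (branch 70 (branch 70 ∅ (branch 90 ∅ ∅ ∅) ∅) (branch 90 ∅ ∅ ∅) ∅) ∅) (branch 65 (branch 70 ∅ (branch 90 ∅ ∅
  ∅) ∅) (branch 85 ∅ ∅ ∅) ∅) ∅) ∅) ∅) (branch 30 (branch 30 (branch 30 (branch 30 ∅ (branch 50 ∅ ∅ ∅) ∅)
  (branch 50 (branch 50 ∅ (branch 70 ∅ ∅ ∅) ∅) (branch 65 ∅ ∅ ∅) ∅) ∅) (branch 50 (branch 50 (branch 50 ∅
  (branch 70 ∅ ∅ ∅) ∅) (branch 70 (branch 70 ∅ (branch 90 ∅ ∅ ∅) ∅) (branch 90 ∅ ∅ ∅) ∅) ∅) (branch 65
  (branch 70 ∅ (branch 90 ∅ ∅ ∅) ∅) (branch 85 ∅ ∅ ∅) ∅) ∅) ∅) (branch 45 (branch 50 (branch 50 ∅ (branch 70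
  ∅ ∅ ∅) ∅) (branch 70 (branch 70 ∅ (branch 90 ∅ ∅ ∅) ∅) (branch 90 ∅ ∅ ∅) ∅) ∅) (branch 65 (branch 70 ∅
  (branch 90 ∅ ∅ ∅) ∅) (branch 85 ∅ ∅ ∅) ∅) ∅) ∅) ∅) ∅) (branch 15 (branch 15 (branch 15 (branch 15 (branch
  15 ∅ (branch 30 ∅ ∅ ∅) ∅) (branch 30 (branch 30 ∅ (branch 50 ∅ ∅ ∅) ∅) (branch 45 ∅ ∅ ∅) ∅) ∅) (branch 30
  (branch 30 (branch 30 ∅ (branch 50 ∅ ∅ ∅) ∅) (branch 50 (branch 50 ∅ (branch 70 ∅ ∅ ∅) ∅) (branch 65 ∅ ∅ ∅)
  ∅) ∅) (branch 45 (branch 50 ∅ (branch 70 ∅ ∅ ∅) ∅) (branch 65 ∅ ∅ ∅) ∅) ∅) ∅) (branch 30 (branch 30 (branch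
  30 (branch 30 ∅ (branch 50 ∅ ∅ ∅) ∅) (branch 50 (branch 50 ∅ (branch 70 ∅ ∅ ∅) ∅) (branch 65 ∅ ∅ ∅) ∅) ∅)
  (branch 50 (branch 50 (branch 50 ∅ (branch 70 ∅ ∅ ∅) ∅) (branch 70 (branch 70 ∅ (branch 90 ∅ ∅ ∅) ∅)
  (branch 90 ∅ ∅ ∅) ∅) ∅) (branch 65 (branch 70 ∅ (branch 90 ∅ ∅ ∅) ∅) (branch 85 ∅ ∅ ∅) ∅) ∅) ∅) (branch 45
  (branch 50 (branch 50 ∅ (branch 70 ∅ ∅ ∅) ∅) (branch 70 (branch 70 ∅ (branch 90 ∅ ∅ ∅) ∅) (branch 90 ∅ ∅ ∅)
  ∅) ∅) (branch 65 (branch 70 ∅ (branch 90 ∅ ∅ ∅) ∅) (branch 85 ∅ ∅ ∅) ∅) ∅) ∅) ∅) (branch 30 (branch 30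
  (branch 30 (branch 30 ∅ (branch 50 ∅ ∅ ∅) ∅) (branch 50 (branch 50 ∅ (branch 70 ∅ ∅ ∅) ∅) (branch 65 ∅ ∅ ∅)
  ∅) ∅) (branch 50 (branch 50 (branch 50 ∅ (branch 70 ∅ ∅ ∅) ∅) (branch 70 (branch 70 ∅ (branch 90 ∅ ∅ ∅) ∅)
  (branch 90 ∅ ∅ ∅) ∅) ∅) (branch 65 (branch 70 ∅ (branch 90 ∅ ∅ ∅) ∅) (branch 85 ∅ ∅ ∅) ∅) ∅) ∅) (branch 45
  (branch 50 (branch 50 ∅ (branch 70 ∅ ∅ ∅) ∅) (branch 70 (branch 70 ∅ (branch 90 ∅ ∅ ∅) ∅) (branch 90 ∅ ∅ ∅)
  ∅) ∅) (branch 65 (branch 70 ∅ (branch 90 ∅ ∅ ∅) ∅) (branch 85 ∅ ∅ ∅) ∅) ∅) ∅) ∅) ∅) ∅) (branch 0 (branch 5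
  (branch 5 (branch 5 (branch 5 (branch 5 (branch 5 ∅ (branch 15 ∅ ∅ ∅) ∅) (branch 15 (branch 15 ∅ (branch 30
  ∅ ∅ ∅) ∅) (branch 30 ∅ ∅ ∅) ∅) ∅) (branch 15 (branch 15 (branch 15 ∅ (branch 30 ∅ ∅ ∅) ∅) (branch 30
  (branch 30 ∅ (branch 50 ∅ ∅ ∅) ∅) (branch 45 ∅ ∅ ∅) ∅) ∅) (branch 30 (branch 30 ∅ (branch 50 ∅ ∅ ∅) ∅)
  (branch 45 ∅ ∅ ∅) ∅) ∅) ∅) (branch 15 (branch 15 (branch 15 (branch 15 ∅ (branch 30 ∅ ∅ ∅) ∅) (branch 30
  (branch 30 ∅ (branch 50 ∅ ∅ ∅) ∅) (branch 45 ∅ ∅ ∅) ∅) ∅) (branch 30 (branch 30 (branch 30 ∅ (branch 50 ∅ ∅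
  ∅) ∅) (branch 50 (branch 50 ∅ (branch 70 ∅ ∅ ∅) ∅) (branch 65 ∅ ∅ ∅) ∅) ∅) (branch 45 (branch 50 ∅ (branch
  70 ∅ ∅ ∅) ∅) (branch 65 ∅ ∅ ∅) ∅) ∅) ∅) (branch 30 (branch 30 (branch 30 ∅ (branch 50 ∅ ∅ ∅) ∅) (branch 50
  (branch 50 ∅ (branch 70 ∅ ∅ ∅) ∅) (branch 65 ∅ ∅ ∅) ∅) ∅) (branch 45 (branch 50 ∅ (branch 70 ∅ ∅ ∅) ∅)
  (branch 65 ∅ ∅ ∅) ∅) ∅) ∅) ∅) (branch 15 (branch 15 (branch 15 (branch 15 (branch 15 ∅ (branch 30 ∅ ∅ ∅) ∅)
  (branch 30 (branch 30 ∅ (branch 50 ∅ ∅ ∅) ∅) (branch 45 ∅ ∅ ∅) ∅) ∅) (branch 30 (branch 30 (branch 30 ∅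
  (branch 50 ∅ ∅ ∅) ∅) (branch 50 (branch 50 ∅ (branch 70 ∅ ∅ ∅) ∅) (branch 65 ∅ ∅ ∅) ∅) ∅) (branch 45
  (branch 50 ∅ (branch 70 ∅ ∅ ∅) ∅) (branch 65 ∅ ∅ ∅) ∅) ∅) ∅) (branch 30 (branch 30 (branch 30 (branch 30 ∅
  (branch 50 ∅ ∅ ∅) ∅) (branch 50 (branch 50 ∅ (branch 70 ∅ ∅ ∅) ∅) (branch 65 ∅ ∅ ∅) ∅) ∅) (branch 50
  (branch 50 (branch 50 ∅ (branch 70 ∅ ∅ ∅) ∅) (branch 70 (branch 70 ∅ (branch 90 ∅ ∅ ∅) ∅) (branch 90 ∅ ∅ ∅)
  ∅) ∅) (branch 65 (branch 70 ∅ (branch 90 ∅ ∅ ∅) ∅) (branch 85 ∅ ∅ ∅) ∅) ∅) ∅) (branch 45 (branch 50 (branch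
  50 ∅ (branch 70 ∅ ∅ ∅) ∅) (branch 70 (branch 70 ∅ (branch 90 ∅ ∅ ∅) ∅) (branch 90 ∅ ∅ ∅) ∅) ∅) (branch 65
  (branch 70 ∅ (branch 90 ∅ ∅ ∅) ∅) (branch 85 ∅ ∅ ∅) ∅) ∅) ∅) ∅) (branch 30 (branch 30 (branch 30 (branch 30
  ∅ (branch 50 ∅ ∅ ∅) ∅) (branch 50 (branch 50 ∅ (branch 70 ∅ ∅ ∅) ∅) (branch 65 ∅ ∅ ∅) ∅) ∅) (branch 50
  (branch 50 (branch 50 ∅ (branch 70 ∅ ∅ ∅) ∅) (branch 70 (branch 70 ∅ (branch 90 ∅ ∅ ∅) ∅) (branch 90 ∅ ∅ ∅)
  ∅) ∅) (branch 65 (branch 70 ∅ (branch 90 ∅ ∅ ∅) ∅) (branch 85 ∅ ∅ ∅) ∅) ∅) ∅) (branch 45 (branch 50 (branch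
  50 ∅ (branch 70 ∅ ∅ ∅) ∅) (branch 70 (branch 70 ∅ (branch 90 ∅ ∅ ∅) ∅) (branch 90 ∅ ∅ ∅) ∅) ∅) (branch 65
  (branch 70 ∅ (branch 90 ∅ ∅ ∅) ∅) (branch 85 ∅ ∅ ∅) ∅) ∅) ∅) ∅) ∅) (branch 15 (branch 15 (branch 15 (branch
  15 (branch 15 (branch 15 ∅ (branch 30 ∅ ∅ ∅) ∅) (branch 30 (branch 30 ∅ (branch 50 ∅ ∅ ∅) ∅) (branch 45 ∅ ∅
  ∅) ∅) ∅) (branch 30 (branch 30 (branch 30 ∅ (branch 50 ∅ ∅ ∅) ∅) (branch 50 (branch 50 ∅ (branch 70 ∅ ∅ ∅)
  ∅) (branch 65 ∅ ∅ ∅) ∅) ∅) (branch 45 (branch 50 ∅ (branch 70 ∅ ∅ ∅) ∅) (branch 65 ∅ ∅ ∅) ∅) ∅) ∅) (branch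
  30 (branch 30 (branch 30 (branch 30 ∅ (branch 50 ∅ ∅ ∅) ∅) (branch 50 (branch 50 ∅ (branch 70 ∅ ∅ ∅) ∅)
  (branch 65 ∅ ∅ ∅) ∅) ∅) (branch 50 (branch 50 (branch 50 ∅ (branch 70 ∅ ∅ ∅) ∅) (branch 70 (branch 70 ∅
  (branch 90 ∅ ∅ ∅) ∅) (branch 90 ∅ ∅ ∅) ∅) ∅) (branch 65 (branch 70 ∅ (branch 90 ∅ ∅ ∅) ∅) (branch 85 ∅ ∅ ∅)
  ∅) ∅) ∅) (branch 45 (branch 50 (branch 50 ∅ (branch 70 ∅ ∅ ∅) ∅) (branch 70 (branch 70 ∅ (branch 90 ∅ ∅ ∅)
  ∅) (branch 90 ∅ ∅ ∅) ∅) ∅) (branch 65 (branch 70 ∅ (branch 90 ∅ ∅ ∅) ∅) (branch 85 ∅ ∅ ∅) ∅) ∅) ∅) ∅)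
  (branch 30 (branch 30 (branch 30 (branch 30 (branch 30 ∅ (branch 50 ∅ ∅ ∅) ∅) (branch 50 (branch 50 ∅
  (branch 70 ∅ ∅ ∅) ∅) (branch 65 ∅ ∅ ∅) ∅) ∅) (branch 50 (branch 50 (branch 50 ∅ (branch 70 ∅ ∅ ∅) ∅)
  (branch 70 (branch 70 ∅ (branch 90 ∅ ∅ ∅) ∅) (branch 90 ∅ ∅ ∅) ∅) ∅) (branch 65 (branch 70 ∅ (branch 90 ∅ ∅
  ∅) ∅) (branch 85 ∅ ∅ ∅) ∅) ∅) ∅) (branch 50 (branch 50 (branch 50 (branch 50 ∅ (branch 70 ∅ ∅ ∅) ∅) (branch
  70 (branch 70 ∅ (branch 90 ∅ ∅ ∅) ∅) (branch 90 ∅ ∅ ∅) ∅) ∅) (branch 70 (branch 70 (branch 70 ∅ (branch 90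
  ∅ ∅ ∅) ∅) (branch 90 (branch 90 ∅ (branch 115 ∅ ∅ ∅) ∅) (branch 110 ∅ ∅ ∅) ∅) ∅) (branch 90 (branch 90 ∅
  (branch 115 ∅ ∅ ∅) ∅) (branch 110 ∅ ∅ ∅) ∅) ∅) ∅) (branch 65 (branch 70 (branch 70 ∅ (branch 90 ∅ ∅ ∅) ∅)
  (branch 90 (branch 90 ∅ (branch 110 ∅ ∅ ∅) ∅) (branch 110 ∅ ∅ ∅) ∅) ∅) (branch 85 (branch 90 ∅ (branch 110
  ∅ ∅ ∅) ∅) (branch 105 ∅ ∅ ∅) ∅) ∅) ∅) ∅) (branch 45 (branch 50 (branch 50 (branch 50 ∅ (branch 70 ∅ ∅ ∅) ∅)
  (branch 70 (branch 70 ∅ (branch 90 ∅ ∅ ∅) ∅) (branch 90 ∅ ∅ ∅) ∅) ∅) (branch 70 (branch 70 (branch 70 ∅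
  (branch 90 ∅ ∅ ∅) ∅) (branch 90 (branch 90 ∅ (branch 110 ∅ ∅ ∅) ∅) (branch 110 ∅ ∅ ∅) ∅) ∅) (branch 90
  (branch 90 ∅ (branch 110 ∅ ∅ ∅) ∅) (branch 110 ∅ ∅ ∅) ∅) ∅) ∅) (branch 65 (branch 70 (branch 70 ∅ (branch
  90 ∅ ∅ ∅) ∅) (branch 90 (branch 90 ∅ (branch 110 ∅ ∅ ∅) ∅) (branch 110 ∅ ∅ ∅) ∅) ∅) (branch 85 (branch 90 ∅
  (branch 110 ∅ ∅ ∅) ∅) (branch 105 ∅ ∅ ∅) ∅) ∅) ∅) ∅) ∅) (branch 30 (branch 30 (branch 30 (branch 30 (branch
  30 ∅ (branch 50 ∅ ∅ ∅) ∅) (branch 50 (branch 50 ∅ (branch 70 ∅ ∅ ∅) ∅) (branch 65 ∅ ∅ ∅) ∅) ∅) (branch 50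
  (branch 50 (branch 50 ∅ (branch 70 ∅ ∅ ∅) ∅) (branch 70 (branch 70 ∅ (branch 90 ∅ ∅ ∅) ∅) (branch 90 ∅ ∅ ∅)
  ∅) ∅) (branch 65 (branch 70 ∅ (branch 90 ∅ ∅ ∅) ∅) (branch 85 ∅ ∅ ∅) ∅) ∅) ∅) (branch 50 (branch 50 (branch
  50 (branch 50 ∅ (branch 70 ∅ ∅ ∅) ∅) (branch 70 (branch 70 ∅ (branch 90 ∅ ∅ ∅) ∅) (branch 90 ∅ ∅ ∅) ∅) ∅)
  (branch 70 (branch 70 (branch 70 ∅ (branch 90 ∅ ∅ ∅) ∅) (branch 90 (branch 90 ∅ (branch 115 ∅ ∅ ∅) ∅)
  (branch 110 ∅ ∅ ∅) ∅) ∅) (branch 90 (branch 90 ∅ (branch 115 ∅ ∅ ∅) ∅) (branch 110 ∅ ∅ ∅) ∅) ∅) ∅) (branch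
  65 (branch 70 (branch 70 ∅ (branch 90 ∅ ∅ ∅) ∅) (branch 90 (branch 90 ∅ (branch 110 ∅ ∅ ∅) ∅) (branch 110 ∅
  ∅ ∅) ∅) ∅) (branch 85 (branch 90 ∅ (branch 110 ∅ ∅ ∅) ∅) (branch 105 ∅ ∅ ∅) ∅) ∅) ∅) ∅) (branch 45 (branch
  50 (branch 50 (branch 50 ∅ (branch 70 ∅ ∅ ∅) ∅) (branch 70 (branch 70 ∅ (branch 90 ∅ ∅ ∅) ∅) (branch 90 ∅ ∅
  ∅) ∅) ∅) (branch 70 (branch 70 (branch 70 ∅ (branch 90 ∅ ∅ ∅) ∅) (branch 90 (branch 90 ∅ (branch 110 ∅ ∅ ∅)
  ∅) (branch 110 ∅ ∅ ∅) ∅) ∅) (branch 90 (branch 90 ∅ (branch 110 ∅ ∅ ∅) ∅) (branch 110 ∅ ∅ ∅) ∅) ∅) ∅)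
  (branch 65 (branch 70 (branch 70 ∅ (branch 90 ∅ ∅ ∅) ∅) (branch 90 (branch 90 ∅ (branch 110 ∅ ∅ ∅) ∅)
  (branch 110 ∅ ∅ ∅) ∅) ∅) (branch 85 (branch 90 ∅ (branch 110 ∅ ∅ ∅) ∅) (branch 105 ∅ ∅ ∅) ∅) ∅) ∅) ∅) ∅) ∅)
  (branch 10 (branch 15 (branch 15 (branch 15 (branch 15 (branch 15 ∅ (branch 30 ∅ ∅ ∅) ∅) (branch 30 (branch
  30 ∅ (branch 45 ∅ ∅ ∅) ∅) (branch 45 ∅ ∅ ∅) ∅) ∅) (branch 30 (branch 30 (branch 30 ∅ (branch 45 ∅ ∅ ∅) ∅)
  (branch 45 (branch 45 ∅ (branch 65 ∅ ∅ ∅) ∅) (branch 65 ∅ ∅ ∅) ∅) ∅) (branch 45 (branch 45 ∅ (branch 65 ∅ ∅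
  ∅) ∅) (branch 65 ∅ ∅ ∅) ∅) ∅) ∅) (branch 30 (branch 30 (branch 30 (branch 30 ∅ (branch 45 ∅ ∅ ∅) ∅) (branch
  45 (branch 45 ∅ (branch 65 ∅ ∅ ∅) ∅) (branch 65 ∅ ∅ ∅) ∅) ∅) (branch 45 (branch 45 (branch 45 ∅ (branch 65
  ∅ ∅ ∅) ∅) (branch 65 (branch 65 ∅ (branch 90 ∅ ∅ ∅) ∅) (branch 85 ∅ ∅ ∅) ∅) ∅) (branch 65 (branch 65 ∅
  (branch 90 ∅ ∅ ∅) ∅) (branch 85 ∅ ∅ ∅) ∅) ∅) ∅) (branch 45 (branch 45 (branch 45 ∅ (branch 65 ∅ ∅ ∅) ∅)
  (branch 65 (branch 65 ∅ (branch 90 ∅ ∅ ∅) ∅) (branch 85 ∅ ∅ ∅) ∅) ∅) (branch 65 (branch 65 ∅ (branch 90 ∅ ∅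
  ∅) ∅) (branch 85 ∅ ∅ ∅) ∅) ∅) ∅) ∅) (branch 30 (branch 30 (branch 30 (branch 30 (branch 30 ∅ (branch 45 ∅ ∅
  ∅) ∅) (branch 45 (branch 45 ∅ (branch 65 ∅ ∅ ∅) ∅) (branch 65 ∅ ∅ ∅) ∅) ∅) (branch 45 (branch 45 (branch 45
  ∅ (branch 65 ∅ ∅ ∅) ∅) (branch 65 (branch 65 ∅ (branch 90 ∅ ∅ ∅) ∅) (branch 85 ∅ ∅ ∅) ∅) ∅) (branch 65
  (branch 65 ∅ (branch 90 ∅ ∅ ∅) ∅) (branch 85 ∅ ∅ ∅) ∅) ∅) ∅) (branch 45 (branch 45 (branch 45 (branch 45 ∅
  (branch 65 ∅ ∅ ∅) ∅) (branch 65 (branch 65 ∅ (branch 90 ∅ ∅ ∅) ∅) (branch 85 ∅ ∅ ∅) ∅) ∅) (branch 65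
  (branch 65 (branch 65 ∅ (branch 90 ∅ ∅ ∅) ∅) (branch 90 (branch 90 ∅ (branch 110 ∅ ∅ ∅) ∅) (branch 110 ∅ ∅
  ∅) ∅) ∅) (branch 85 (branch 90 ∅ (branch 110 ∅ ∅ ∅) ∅) (branch 105 ∅ ∅ ∅) ∅) ∅) ∅) (branch 65 (branch 65
  (branch 65 ∅ (branch 90 ∅ ∅ ∅) ∅) (branch 90 (branch 90 ∅ (branch 110 ∅ ∅ ∅) ∅) (branch 110 ∅ ∅ ∅) ∅) ∅)
  (branch 85 (branch 90 ∅ (branch 110 ∅ ∅ ∅) ∅) (branch 105 ∅ ∅ ∅) ∅) ∅) ∅) ∅) (branch 45 (branch 45 (branch
  45 (branch 45 ∅ (branch 65 ∅ ∅ ∅) ∅) (branch 65 (branch 65 ∅ (branch 90 ∅ ∅ ∅) ∅) (branch 85 ∅ ∅ ∅) ∅) ∅)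
  (branch 65 (branch 65 (branch 65 ∅ (branch 90 ∅ ∅ ∅) ∅) (branch 90 (branch 90 ∅ (branch 110 ∅ ∅ ∅) ∅)
  (branch 110 ∅ ∅ ∅) ∅) ∅) (branch 85 (branch 90 ∅ (branch 110 ∅ ∅ ∅) ∅) (branch 105 ∅ ∅ ∅) ∅) ∅) ∅) (branch
  65 (branch 65 (branch 65 ∅ (branch 90 ∅ ∅ ∅) ∅) (branch 90 (branch 90 ∅ (branch 110 ∅ ∅ ∅) ∅) (branch 110 ∅
  ∅ ∅) ∅) ∅) (branch 85 (branch 90 ∅ (branch 110 ∅ ∅ ∅) ∅) (branch 105 ∅ ∅ ∅) ∅) ∅) ∅) ∅) ∅) (branch 25
  (branch 30 (branch 30 (branch 30 (branch 30 ∅ (branch 45 ∅ ∅ ∅) ∅) (branch 45 (branch 45 ∅ (branch 65 ∅ ∅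
  ∅) ∅) (branch 65 ∅ ∅ ∅) ∅) ∅) (branch 45 (branch 45 (branch 45 ∅ (branch 65 ∅ ∅ ∅) ∅) (branch 65 (branch 65
  ∅ (branch 85 ∅ ∅ ∅) ∅) (branch 85 ∅ ∅ ∅) ∅) ∅) (branch 65 (branch 65 ∅ (branch 85 ∅ ∅ ∅) ∅) (branch 85 ∅ ∅
  ∅) ∅) ∅) ∅) (branch 45 (branch 45 (branch 45 (branch 45 ∅ (branch 65 ∅ ∅ ∅) ∅) (branch 65 (branch 65 ∅
  (branch 85 ∅ ∅ ∅) ∅) (branch 85 ∅ ∅ ∅) ∅) ∅) (branch 65 (branch 65 (branch 65 ∅ (branch 85 ∅ ∅ ∅) ∅)
  (branch 85 (branch 85 ∅ (branch 110 ∅ ∅ ∅) ∅) (branch 105 ∅ ∅ ∅) ∅) ∅) (branch 85 (branch 85 ∅ (branch 110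
  ∅ ∅ ∅) ∅) (branch 105 ∅ ∅ ∅) ∅) ∅) ∅) (branch 65 (branch 65 (branch 65 ∅ (branch 85 ∅ ∅ ∅) ∅) (branch 85
  (branch 85 ∅ (branch 110 ∅ ∅ ∅) ∅) (branch 105 ∅ ∅ ∅) ∅) ∅) (branch 85 (branch 85 ∅ (branch 110 ∅ ∅ ∅) ∅)
  (branch 105 ∅ ∅ ∅) ∅) ∅) ∅) ∅) (branch 40 (branch 45 (branch 45 (branch 45 ∅ (branch 65 ∅ ∅ ∅) ∅) (branch
  65 (branch 65 ∅ (branch 85 ∅ ∅ ∅) ∅) (branch 85 ∅ ∅ ∅) ∅) ∅) (branch 65 (branch 65 (branch 65 ∅ (branch 85
  ∅ ∅ ∅) ∅) (branch 85 (branch 85 ∅ (branch 105 ∅ ∅ ∅) ∅) (branch 105 ∅ ∅ ∅) ∅) ∅) (branch 85 (branch 85 ∅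
  (branch 105 ∅ ∅ ∅) ∅) (branch 105 ∅ ∅ ∅) ∅) ∅) ∅) (branch 60 (branch 65 (branch 65 ∅ (branch 85 ∅ ∅ ∅) ∅)
  (branch 85 (branch 85 ∅ (branch 105 ∅ ∅ ∅) ∅) (branch 105 ∅ ∅ ∅) ∅) ∅) (branch 80 (branch 85 ∅ (branch 105
  ∅ ∅ ∅) ∅) (branch 100 ∅ ∅ ∅) ∅) ∅) ∅) ∅) ∅) ∅) (branch 0 (branch 7 (branch 7 (branch 7 (branch 7 (branch 7
  (branch 7 ∅ (branch 17 ∅ ∅ ∅) ∅) (branch 17 (branch 17 ∅ (branch 32 ∅ ∅ ∅) ∅) (branch 32 ∅ ∅ ∅) ∅) ∅)
  (branch 17 (branch 17 (branch 17 ∅ (branch 32 ∅ ∅ ∅) ∅) (branch 32 (branch 32 ∅ (branch 52 ∅ ∅ ∅) ∅)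
  (branch 49 ∅ ∅ ∅) ∅) ∅) (branch 32 (branch 32 ∅ (branch 52 ∅ ∅ ∅) ∅) (branch 49 ∅ ∅ ∅) ∅) ∅) ∅) (branch 17
  (branch 17 (branch 17 (branch 17 ∅ (branch 32 ∅ ∅ ∅) ∅) (branch 32 (branch 32 ∅ (branch 52 ∅ ∅ ∅) ∅)
  (branch 49 ∅ ∅ ∅) ∅) ∅) (branch 32 (branch 32 (branch 32 ∅ (branch 52 ∅ ∅ ∅) ∅) (branch 52 (branch 52 ∅
  (branch 74 ∅ ∅ ∅) ∅) (branch 69 ∅ ∅ ∅) ∅) ∅) (branch 49 (branch 52 ∅ (branch 74 ∅ ∅ ∅) ∅) (branch 69 ∅ ∅ ∅)
  ∅) ∅) ∅) (branch 32 (branch 32 (branch 32 ∅ (branch 52 ∅ ∅ ∅) ∅) (branch 52 (branch 52 ∅ (branch 74 ∅ ∅ ∅)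
  ∅) (branch 69 ∅ ∅ ∅) ∅) ∅) (branch 49 (branch 52 ∅ (branch 74 ∅ ∅ ∅) ∅) (branch 69 ∅ ∅ ∅) ∅) ∅) ∅) ∅)
  (branch 17 (branch 17 (branch 17 (branch 17 (branch 17 ∅ (branch 32 ∅ ∅ ∅) ∅) (branch 32 (branch 32 ∅
  (branch 52 ∅ ∅ ∅) ∅) (branch 49 ∅ ∅ ∅) ∅) ∅) (branch 32 (branch 32 (branch 32 ∅ (branch 52 ∅ ∅ ∅) ∅)
  (branch 52 (branch 52 ∅ (branch 74 ∅ ∅ ∅) ∅) (branch 69 ∅ ∅ ∅) ∅) ∅) (branch 49 (branch 52 ∅ (branch 74 ∅ ∅
  ∅) ∅) (branch 69 ∅ ∅ ∅) ∅) ∅) ∅) (branch 32 (branch 32 (branch 32 (branch 32 ∅ (branch 52 ∅ ∅ ∅) ∅) (branch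
  52 (branch 52 ∅ (branch 74 ∅ ∅ ∅) ∅) (branch 69 ∅ ∅ ∅) ∅) ∅) (branch 52 (branch 52 (branch 52 ∅ (branch 74
  ∅ ∅ ∅) ∅) (branch 74 (branch 74 ∅ (branch 94 ∅ ∅ ∅) ∅) (branch 94 ∅ ∅ ∅) ∅) ∅) (branch 69 (branch 74 ∅
  (branch 94 ∅ ∅ ∅) ∅) (branch 89 ∅ ∅ ∅) ∅) ∅) ∅) (branch 49 (branch 52 (branch 52 ∅ (branch 74 ∅ ∅ ∅) ∅)
  (branch 74 (branch 74 ∅ (branch 94 ∅ ∅ ∅) ∅) (branch 94 ∅ ∅ ∅) ∅) ∅) (branch 69 (branch 74 ∅ (branch 94 ∅ ∅
  ∅) ∅) (branch 89 ∅ ∅ ∅) ∅) ∅) ∅) ∅) (branch 32 (branch 32 (branch 32 (branch 32 ∅ (branch 52 ∅ ∅ ∅) ∅)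
  (branch 52 (branch 52 ∅ (branch 74 ∅ ∅ ∅) ∅) (branch 69 ∅ ∅ ∅) ∅) ∅) (branch 52 (branch 52 (branch 52 ∅
  (branch 74 ∅ ∅ ∅) ∅) (branch 74 (branch 74 ∅ (branch 94 ∅ ∅ ∅) ∅) (branch 94 ∅ ∅ ∅) ∅) ∅) (branch 69
  (branch 74 ∅ (branch 94 ∅ ∅ ∅) ∅) (branch 89 ∅ ∅ ∅) ∅) ∅) ∅) (branch 49 (branch 52 (branch 52 ∅ (branch 74
  ∅ ∅ ∅) ∅) (branch 74 (branch 74 ∅ (branch 94 ∅ ∅ ∅) ∅) (branch 94 ∅ ∅ ∅) ∅) ∅) (branch 69 (branch 74 ∅
  (branch 94 ∅ ∅ ∅) ∅) (branch 89 ∅ ∅ ∅) ∅) ∅) ∅) ∅) ∅) (branch 17 (branch 17 (branch 17 (branch 17 (branch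
  17 (branch 17 ∅ (branch 32 ∅ ∅ ∅) ∅) (branch 32 (branch 32 ∅ (branch 52 ∅ ∅ ∅) ∅) (branch 49 ∅ ∅ ∅) ∅) ∅)
  (branch 32 (branch 32 (branch 32 ∅ (branch 52 ∅ ∅ ∅) ∅) (branch 52 (branch 52 ∅ (branch 74 ∅ ∅ ∅) ∅)
  (branch 69 ∅ ∅ ∅) ∅) ∅) (branch 49 (branch 52 ∅ (branch 74 ∅ ∅ ∅) ∅) (branch 69 ∅ ∅ ∅) ∅) ∅) ∅) (branch 32
  (branch 32 (branch 32 (branch 32 ∅ (branch 52 ∅ ∅ ∅) ∅) (branch 52 (branch 52 ∅ (branch 74 ∅ ∅ ∅) ∅)
  (branch 69 ∅ ∅ ∅) ∅) ∅) (branch 52 (branch 52 (branch 52 ∅ (branch 74 ∅ ∅ ∅) ∅) (branch 74 (branch 74 ∅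
  (branch 94 ∅ ∅ ∅) ∅) (branch 94 ∅ ∅ ∅) ∅) ∅) (branch 69 (branch 74 ∅ (branch 94 ∅ ∅ ∅) ∅) (branch 89 ∅ ∅ ∅)
  ∅) ∅) ∅) (branch 49 (branch 52 (branch 52 ∅ (branch 74 ∅ ∅ ∅) ∅) (branch 74 (branch 74 ∅ (branch 94 ∅ ∅ ∅)
  ∅) (branch 94 ∅ ∅ ∅) ∅) ∅) (branch 69 (branch 74 ∅ (branch 94 ∅ ∅ ∅) ∅) (branch 89 ∅ ∅ ∅) ∅) ∅) ∅) ∅)
  (branch 32 (branch 32 (branch 32 (branch 32 (branch 32 ∅ (branch 52 ∅ ∅ ∅) ∅) (branch 52 (branch 52 ∅
  (branch 74 ∅ ∅ ∅) ∅) (branch 69 ∅ ∅ ∅) ∅) ∅) (branch 52 (branch 52 (branch 52 ∅ (branch 74 ∅ ∅ ∅) ∅)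
  (branch 74 (branch 74 ∅ (branch 94 ∅ ∅ ∅) ∅) (branch 94 ∅ ∅ ∅) ∅) ∅) (branch 69 (branch 74 ∅ (branch 94 ∅ ∅
  ∅) ∅) (branch 89 ∅ ∅ ∅) ∅) ∅) ∅) (branch 52 (branch 52 (branch 52 (branch 52 ∅ (branch 74 ∅ ∅ ∅) ∅) (branch
  74 (branch 74 ∅ (branch 94 ∅ ∅ ∅) ∅) (branch 94 ∅ ∅ ∅) ∅) ∅) (branch 74 (branch 74 (branch 74 ∅ (branch 94
  ∅ ∅ ∅) ∅) (branch 94 (branch 94 ∅ (branch 119 ∅ ∅ ∅) ∅) (branch 114 ∅ ∅ ∅) ∅) ∅) (branch 94 (branch 94 ∅
  (branch 119 ∅ ∅ ∅) ∅) (branch 114 ∅ ∅ ∅) ∅) ∅) ∅) (branch 69 (branch 74 (branch 74 ∅ (branch 94 ∅ ∅ ∅) ∅)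
  (branch 94 (branch 94 ∅ (branch 114 ∅ ∅ ∅) ∅) (branch 114 ∅ ∅ ∅) ∅) ∅) (branch 89 (branch 94 ∅ (branch 114
  ∅ ∅ ∅) ∅) (branch 109 ∅ ∅ ∅) ∅) ∅) ∅) ∅) (branch 49 (branch 52 (branch 52 (branch 52 ∅ (branch 74 ∅ ∅ ∅) ∅)
  (branch 74 (branch 74 ∅ (branch 94 ∅ ∅ ∅) ∅) (branch 94 ∅ ∅ ∅) ∅) ∅) (branch 74 (branch 74 (branch 74 ∅
  (branch 94 ∅ ∅ ∅) ∅) (branch 94 (branch 94 ∅ (branch 116 ∅ ∅ ∅) ∅) (branch 114 ∅ ∅ ∅) ∅) ∅) (branch 94
  (branch 94 ∅ (branch 116 ∅ ∅ ∅) ∅) (branch 114 ∅ ∅ ∅) ∅) ∅) ∅) (branch 69 (branch 74 (branch 74 ∅ (branch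
  94 ∅ ∅ ∅) ∅) (branch 94 (branch 94 ∅ (branch 114 ∅ ∅ ∅) ∅) (branch 114 ∅ ∅ ∅) ∅) ∅) (branch 89 (branch 94 ∅
  (branch 114 ∅ ∅ ∅) ∅) (branch 109 ∅ ∅ ∅) ∅) ∅) ∅) ∅) ∅) (branch 32 (branch 32 (branch 32 (branch 32 (branch
  32 ∅ (branch 52 ∅ ∅ ∅) ∅) (branch 52 (branch 52 ∅ (branch 74 ∅ ∅ ∅) ∅) (branch 69 ∅ ∅ ∅) ∅) ∅) (branch 52
  (branch 52 (branch 52 ∅ (branch 74 ∅ ∅ ∅) ∅) (branch 74 (branch 74 ∅ (branch 94 ∅ ∅ ∅) ∅) (branch 94 ∅ ∅ ∅)
  ∅) ∅) (branch 69 (branch 74 ∅ (branch 94 ∅ ∅ ∅) ∅) (branch 89 ∅ ∅ ∅) ∅) ∅) ∅) (branch 52 (branch 52 (branch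
  52 (branch 52 ∅ (branch 74 ∅ ∅ ∅) ∅) (branch 74 (branch 74 ∅ (branch 94 ∅ ∅ ∅) ∅) (branch 94 ∅ ∅ ∅) ∅) ∅)
  (branch 74 (branch 74 (branch 74 ∅ (branch 94 ∅ ∅ ∅) ∅) (branch 94 (branch 94 ∅ (branch 119 ∅ ∅ ∅) ∅)
  (branch 114 ∅ ∅ ∅) ∅) ∅) (branch 94 (branch 94 ∅ (branch 119 ∅ ∅ ∅) ∅) (branch 114 ∅ ∅ ∅) ∅) ∅) ∅) (branch
  69 (branch 74 (branch 74 ∅ (branch 94 ∅ ∅ ∅) ∅) (branch 94 (branch 94 ∅ (branch 114 ∅ ∅ ∅) ∅) (branch 114 ∅
  ∅ ∅) ∅) ∅) (branch 89 (branch 94 ∅ (branch 114 ∅ ∅ ∅) ∅) (branch 109 ∅ ∅ ∅) ∅) ∅) ∅) ∅) (branch 49 (branch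
  52 (branch 52 (branch 52 ∅ (branch 74 ∅ ∅ ∅) ∅) (branch 74 (branch 74 ∅ (branch 94 ∅ ∅ ∅) ∅) (branch 94 ∅ ∅
  ∅) ∅) ∅) (branch 74 (branch 74 (branch 74 ∅ (branch 94 ∅ ∅ ∅) ∅) (branch 94 (branch 94 ∅ (branch 116 ∅ ∅ ∅)
  ∅) (branch 114 ∅ ∅ ∅) ∅) ∅) (branch 94 (branch 94 ∅ (branch 116 ∅ ∅ ∅) ∅) (branch 114 ∅ ∅ ∅) ∅) ∅) ∅)
  (branch 69 (branch 74 (branch 74 ∅ (branch 94 ∅ ∅ ∅) ∅) (branch 94 (branch 94 ∅ (branch 114 ∅ ∅ ∅) ∅)
  (branch 114 ∅ ∅ ∅) ∅) ∅) (branch 89 (branch 94 ∅ (branch 114 ∅ ∅ ∅) ∅) (branch 109 ∅ ∅ ∅) ∅) ∅) ∅) ∅) ∅) ∅)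
  (branch 12 (branch 17 (branch 17 (branch 17 (branch 17 (branch 17 (branch 17 ∅ (branch 32 ∅ ∅ ∅) ∅) (branch
  32 (branch 32 ∅ (branch 49 ∅ ∅ ∅) ∅) (branch 49 ∅ ∅ ∅) ∅) ∅) (branch 32 (branch 32 (branch 32 ∅ (branch 49
  ∅ ∅ ∅) ∅) (branch 49 (branch 49 ∅ (branch 69 ∅ ∅ ∅) ∅) (branch 69 ∅ ∅ ∅) ∅) ∅) (branch 49 (branch 49 ∅
  (branch 69 ∅ ∅ ∅) ∅) (branch 69 ∅ ∅ ∅) ∅) ∅) ∅) (branch 32 (branch 32 (branch 32 (branch 32 ∅ (branch 49 ∅
  ∅ ∅) ∅) (branch 49 (branch 49 ∅ (branch 69 ∅ ∅ ∅) ∅) (branch 69 ∅ ∅ ∅) ∅) ∅) (branch 49 (branch 49 (branch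
  49 ∅ (branch 69 ∅ ∅ ∅) ∅) (branch 69 (branch 69 ∅ (branch 94 ∅ ∅ ∅) ∅) (branch 89 ∅ ∅ ∅) ∅) ∅) (branch 69
  (branch 69 ∅ (branch 94 ∅ ∅ ∅) ∅) (branch 89 ∅ ∅ ∅) ∅) ∅) ∅) (branch 49 (branch 49 (branch 49 ∅ (branch 69
  ∅ ∅ ∅) ∅) (branch 69 (branch 69 ∅ (branch 94 ∅ ∅ ∅) ∅) (branch 89 ∅ ∅ ∅) ∅) ∅) (branch 69 (branch 69 ∅
  (branch 94 ∅ ∅ ∅) ∅) (branch 89 ∅ ∅ ∅) ∅) ∅) ∅) ∅) (branch 32 (branch 32 (branch 32 (branch 32 (branch 32 ∅
  (branch 49 ∅ ∅ ∅) ∅) (branch 49 (branch 49 ∅ (branch 69 ∅ ∅ ∅) ∅) (branch 69 ∅ ∅ ∅) ∅) ∅) (branch 49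
  (branch 49 (branch 49 ∅ (branch 69 ∅ ∅ ∅) ∅) (branch 69 (branch 69 ∅ (branch 94 ∅ ∅ ∅) ∅) (branch 89 ∅ ∅ ∅)
  ∅) ∅) (branch 69 (branch 69 ∅ (branch 94 ∅ ∅ ∅) ∅) (branch 89 ∅ ∅ ∅) ∅) ∅) ∅) (branch 49 (branch 49 (branch
  49 (branch 49 ∅ (branch 69 ∅ ∅ ∅) ∅) (branch 69 (branch 69 ∅ (branch 94 ∅ ∅ ∅) ∅) (branch 89 ∅ ∅ ∅) ∅) ∅)
  (branch 69 (branch 69 (branch 69 ∅ (branch 94 ∅ ∅ ∅) ∅) (branch 94 (branch 94 ∅ (branch 116 ∅ ∅ ∅) ∅)
  (branch 114 ∅ ∅ ∅) ∅) ∅) (branch 89 (branch 94 ∅ (branch 116 ∅ ∅ ∅) ∅) (branch 111 ∅ ∅ ∅) ∅) ∅) ∅) (branch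
  69 (branch 69 (branch 69 ∅ (branch 94 ∅ ∅ ∅) ∅) (branch 94 (branch 94 ∅ (branch 114 ∅ ∅ ∅) ∅) (branch 114 ∅
  ∅ ∅) ∅) ∅) (branch 89 (branch 94 ∅ (branch 114 ∅ ∅ ∅) ∅) (branch 109 ∅ ∅ ∅) ∅) ∅) ∅) ∅) (branch 49 (branch
  49 (branch 49 (branch 49 ∅ (branch 69 ∅ ∅ ∅) ∅) (branch 69 (branch 69 ∅ (branch 94 ∅ ∅ ∅) ∅) (branch 89 ∅ ∅
  ∅) ∅) ∅) (branch 69 (branch 69 (branch 69 ∅ (branch 94 ∅ ∅ ∅) ∅) (branch 94 (branch 94 ∅ (branch 116 ∅ ∅ ∅)
  ∅) (branch 114 ∅ ∅ ∅) ∅) ∅) (branch 89 (branch 94 ∅ (branch 116 ∅ ∅ ∅) ∅) (branch 111 ∅ ∅ ∅) ∅) ∅) ∅)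
  (branch 69 (branch 69 (branch 69 ∅ (branch 94 ∅ ∅ ∅) ∅) (branch 94 (branch 94 ∅ (branch 114 ∅ ∅ ∅) ∅)
  (branch 114 ∅ ∅ ∅) ∅) ∅) (branch 89 (branch 94 ∅ (branch 114 ∅ ∅ ∅) ∅) (branch 109 ∅ ∅ ∅) ∅) ∅) ∅) ∅) ∅)
  (branch 32 (branch 32 (branch 32 (branch 32 (branch 32 (branch 32 ∅ (branch 49 ∅ ∅ ∅) ∅) (branch 49 (branch
  49 ∅ (branch 69 ∅ ∅ ∅) ∅) (branch 69 ∅ ∅ ∅) ∅) ∅) (branch 49 (branch 49 (branch 49 ∅ (branch 69 ∅ ∅ ∅) ∅)
  (branch 69 (branch 69 ∅ (branch 94 ∅ ∅ ∅) ∅) (branch 89 ∅ ∅ ∅) ∅) ∅) (branch 69 (branch 69 ∅ (branch 94 ∅ ∅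
  ∅) ∅) (branch 89 ∅ ∅ ∅) ∅) ∅) ∅) (branch 49 (branch 49 (branch 49 (branch 49 ∅ (branch 69 ∅ ∅ ∅) ∅) (branch
  69 (branch 69 ∅ (branch 94 ∅ ∅ ∅) ∅) (branch 89 ∅ ∅ ∅) ∅) ∅) (branch 69 (branch 69 (branch 69 ∅ (branch 94
  ∅ ∅ ∅) ∅) (branch 94 (branch 94 ∅ (branch 116 ∅ ∅ ∅) ∅) (branch 114 ∅ ∅ ∅) ∅) ∅) (branch 89 (branch 94 ∅
  (branch 116 ∅ ∅ ∅) ∅) (branch 111 ∅ ∅ ∅) ∅) ∅) ∅) (branch 69 (branch 69 (branch 69 ∅ (branch 94 ∅ ∅ ∅) ∅)
  (branch 94 (branch 94 ∅ (branch 114 ∅ ∅ ∅) ∅) (branch 114 ∅ ∅ ∅) ∅) ∅) (branch 89 (branch 94 ∅ (branch 114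
  ∅ ∅ ∅) ∅) (branch 109 ∅ ∅ ∅) ∅) ∅) ∅) ∅) (branch 49 (branch 49 (branch 49 (branch 49 (branch 49 ∅ (branch
  69 ∅ ∅ ∅) ∅) (branch 69 (branch 69 ∅ (branch 94 ∅ ∅ ∅) ∅) (branch 89 ∅ ∅ ∅) ∅) ∅) (branch 69 (branch 69
  (branch 69 ∅ (branch 94 ∅ ∅ ∅) ∅) (branch 94 (branch 94 ∅ (branch 116 ∅ ∅ ∅) ∅) (branch 114 ∅ ∅ ∅) ∅) ∅)
  (branch 89 (branch 94 ∅ (branch 116 ∅ ∅ ∅) ∅) (branch 111 ∅ ∅ ∅) ∅) ∅) ∅) (branch 69 (branch 69 (branch 69
  (branch 69 ∅ (branch 94 ∅ ∅ ∅) ∅) (branch 94 (branch 94 ∅ (branch 116 ∅ ∅ ∅) ∅) (branch 114 ∅ ∅ ∅) ∅) ∅)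
  (branch 94 (branch 94 (branch 94 ∅ (branch 116 ∅ ∅ ∅) ∅) (branch 116 (branch 116 ∅ (branch 141 ∅ ∅ ∅) ∅)
  (branch 136 ∅ ∅ ∅) ∅) ∅) (branch 114 (branch 116 ∅ (branch 141 ∅ ∅ ∅) ∅) (branch 136 ∅ ∅ ∅) ∅) ∅) ∅)
  (branch 89 (branch 94 (branch 94 ∅ (branch 116 ∅ ∅ ∅) ∅) (branch 116 (branch 116 ∅ (branch 136 ∅ ∅ ∅) ∅)
  (branch 136 ∅ ∅ ∅) ∅) ∅) (branch 111 (branch 116 ∅ (branch 136 ∅ ∅ ∅) ∅) (branch 131 ∅ ∅ ∅) ∅) ∅) ∅) ∅)
  (branch 69 (branch 69 (branch 69 (branch 69 ∅ (branch 94 ∅ ∅ ∅) ∅) (branch 94 (branch 94 ∅ (branch 114 ∅ ∅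
  ∅) ∅) (branch 114 ∅ ∅ ∅) ∅) ∅) (branch 94 (branch 94 (branch 94 ∅ (branch 114 ∅ ∅ ∅) ∅) (branch 114 (branch
  114 ∅ (branch 139 ∅ ∅ ∅) ∅) (branch 136 ∅ ∅ ∅) ∅) ∅) (branch 114 (branch 114 ∅ (branch 139 ∅ ∅ ∅) ∅)
  (branch 136 ∅ ∅ ∅) ∅) ∅) ∅) (branch 89 (branch 94 (branch 94 ∅ (branch 114 ∅ ∅ ∅) ∅) (branch 114 (branch
  114 ∅ (branch 136 ∅ ∅ ∅) ∅) (branch 136 ∅ ∅ ∅) ∅) ∅) (branch 109 (branch 114 ∅ (branch 136 ∅ ∅ ∅) ∅)
  (branch 131 ∅ ∅ ∅) ∅) ∅) ∅) ∅) ∅) (branch 49 (branch 49 (branch 49 (branch 49 (branch 49 ∅ (branch 69 ∅ ∅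
  ∅) ∅) (branch 69 (branch 69 ∅ (branch 94 ∅ ∅ ∅) ∅) (branch 89 ∅ ∅ ∅) ∅) ∅) (branch 69 (branch 69 (branch 69
  ∅ (branch 94 ∅ ∅ ∅) ∅) (branch 94 (branch 94 ∅ (branch 116 ∅ ∅ ∅) ∅) (branch 114 ∅ ∅ ∅) ∅) ∅) (branch 89
  (branch 94 ∅ (branch 116 ∅ ∅ ∅) ∅) (branch 111 ∅ ∅ ∅) ∅) ∅) ∅) (branch 69 (branch 69 (branch 69 (branch 69
  ∅ (branch 94 ∅ ∅ ∅) ∅) (branch 94 (branch 94 ∅ (branch 116 ∅ ∅ ∅) ∅) (branch 114 ∅ ∅ ∅) ∅) ∅) (branch 94
  (branch 94 (branch 94 ∅ (branch 116 ∅ ∅ ∅) ∅) (branch 116 (branch 116 ∅ (branch 141 ∅ ∅ ∅) ∅) (branch 136 ∅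
  ∅ ∅) ∅) ∅) (branch 114 (branch 116 ∅ (branch 141 ∅ ∅ ∅) ∅) (branch 136 ∅ ∅ ∅) ∅) ∅) ∅) (branch 89 (branch
  94 (branch 94 ∅ (branch 116 ∅ ∅ ∅) ∅) (branch 116 (branch 116 ∅ (branch 136 ∅ ∅ ∅) ∅) (branch 136 ∅ ∅ ∅) ∅)
  ∅) (branch 111 (branch 116 ∅ (branch 136 ∅ ∅ ∅) ∅) (branch 131 ∅ ∅ ∅) ∅) ∅) ∅) ∅) (branch 69 (branch 69
  (branch 69 (branch 69 ∅ (branch 94 ∅ ∅ ∅) ∅) (branch 94 (branch 94 ∅ (branch 114 ∅ ∅ ∅) ∅) (branch 114 ∅ ∅
  ∅) ∅) ∅) (branch 94 (branch 94 (branch 94 ∅ (branch 114 ∅ ∅ ∅) ∅) (branch 114 (branch 114 ∅ (branch 139 ∅ ∅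
  ∅) ∅) (branch 136 ∅ ∅ ∅) ∅) ∅) (branch 114 (branch 114 ∅ (branch 139 ∅ ∅ ∅) ∅) (branch 136 ∅ ∅ ∅) ∅) ∅) ∅)
  (branch 89 (branch 94 (branch 94 ∅ (branch 114 ∅ ∅ ∅) ∅) (branch 114 (branch 114 ∅ (branch 136 ∅ ∅ ∅) ∅)
  (branch 136 ∅ ∅ ∅) ∅) ∅) (branch 109 (branch 114 ∅ (branch 136 ∅ ∅ ∅) ∅) (branch 131 ∅ ∅ ∅) ∅) ∅) ∅) ∅) ∅)
  ∅) (branch 27 (branch 32 (branch 32 (branch 32 (branch 32 (branch 32 ∅ (branch 49 ∅ ∅ ∅) ∅) (branch 49
  (branch 49 ∅ (branch 69 ∅ ∅ ∅) ∅) (branch 69 ∅ ∅ ∅) ∅) ∅) (branch 49 (branch 49 (branch 49 ∅ (branch 69 ∅ ∅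
  ∅) ∅) (branch 69 (branch 69 ∅ (branch 89 ∅ ∅ ∅) ∅) (branch 89 ∅ ∅ ∅) ∅) ∅) (branch 69 (branch 69 ∅ (branch
  89 ∅ ∅ ∅) ∅) (branch 89 ∅ ∅ ∅) ∅) ∅) ∅) (branch 49 (branch 49 (branch 49 (branch 49 ∅ (branch 69 ∅ ∅ ∅) ∅)
  (branch 69 (branch 69 ∅ (branch 89 ∅ ∅ ∅) ∅) (branch 89 ∅ ∅ ∅) ∅) ∅) (branch 69 (branch 69 (branch 69 ∅
  (branch 89 ∅ ∅ ∅) ∅) (branch 89 (branch 89 ∅ (branch 114 ∅ ∅ ∅) ∅) (branch 109 ∅ ∅ ∅) ∅) ∅) (branch 89
  (branch 89 ∅ (branch 114 ∅ ∅ ∅) ∅) (branch 109 ∅ ∅ ∅) ∅) ∅) ∅) (branch 69 (branch 69 (branch 69 ∅ (branch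
  89 ∅ ∅ ∅) ∅) (branch 89 (branch 89 ∅ (branch 114 ∅ ∅ ∅) ∅) (branch 109 ∅ ∅ ∅) ∅) ∅) (branch 89 (branch 89 ∅
  (branch 114 ∅ ∅ ∅) ∅) (branch 109 ∅ ∅ ∅) ∅) ∅) ∅) ∅) (branch 49 (branch 49 (branch 49 (branch 49 (branch 49
  ∅ (branch 69 ∅ ∅ ∅) ∅) (branch 69 (branch 69 ∅ (branch 89 ∅ ∅ ∅) ∅) (branch 89 ∅ ∅ ∅) ∅) ∅) (branch 69
  (branch 69 (branch 69 ∅ (branch 89 ∅ ∅ ∅) ∅) (branch 89 (branch 89 ∅ (branch 114 ∅ ∅ ∅) ∅) (branch 109 ∅ ∅
  ∅) ∅) ∅) (branch 89 (branch 89 ∅ (branch 114 ∅ ∅ ∅) ∅) (branch 109 ∅ ∅ ∅) ∅) ∅) ∅) (branch 69 (branch 69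
  (branch 69 (branch 69 ∅ (branch 89 ∅ ∅ ∅) ∅) (branch 89 (branch 89 ∅ (branch 114 ∅ ∅ ∅) ∅) (branch 109 ∅ ∅
  ∅) ∅) ∅) (branch 89 (branch 89 (branch 89 ∅ (branch 114 ∅ ∅ ∅) ∅) (branch 114 (branch 114 ∅ (branch 139 ∅ ∅
  ∅) ∅) (branch 134 ∅ ∅ ∅) ∅) ∅) (branch 109 (branch 114 ∅ (branch 139 ∅ ∅ ∅) ∅) (branch 134 ∅ ∅ ∅) ∅) ∅) ∅)
  (branch 89 (branch 89 (branch 89 ∅ (branch 114 ∅ ∅ ∅) ∅) (branch 114 (branch 114 ∅ (branch 136 ∅ ∅ ∅) ∅)
  (branch 134 ∅ ∅ ∅) ∅) ∅) (branch 109 (branch 114 ∅ (branch 136 ∅ ∅ ∅) ∅) (branch 131 ∅ ∅ ∅) ∅) ∅) ∅) ∅)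
  (branch 69 (branch 69 (branch 69 (branch 69 ∅ (branch 89 ∅ ∅ ∅) ∅) (branch 89 (branch 89 ∅ (branch 114 ∅ ∅
  ∅) ∅) (branch 109 ∅ ∅ ∅) ∅) ∅) (branch 89 (branch 89 (branch 89 ∅ (branch 114 ∅ ∅ ∅) ∅) (branch 114 (branch
  114 ∅ (branch 139 ∅ ∅ ∅) ∅) (branch 134 ∅ ∅ ∅) ∅) ∅) (branch 109 (branch 114 ∅ (branch 139 ∅ ∅ ∅) ∅)
  (branch 134 ∅ ∅ ∅) ∅) ∅) ∅) (branch 89 (branch 89 (branch 89 ∅ (branch 114 ∅ ∅ ∅) ∅) (branch 114 (branch
  114 ∅ (branch 136 ∅ ∅ ∅) ∅) (branch 134 ∅ ∅ ∅) ∅) ∅) (branch 109 (branch 114 ∅ (branch 136 ∅ ∅ ∅) ∅)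
  (branch 131 ∅ ∅ ∅) ∅) ∅) ∅) ∅) ∅) (branch 44 (branch 49 (branch 49 (branch 49 (branch 49 ∅ (branch 69 ∅ ∅
  ∅) ∅) (branch 69 (branch 69 ∅ (branch 89 ∅ ∅ ∅) ∅) (branch 89 ∅ ∅ ∅) ∅) ∅) (branch 69 (branch 69 (branch 69
  ∅ (branch 89 ∅ ∅ ∅) ∅) (branch 89 (branch 89 ∅ (branch 111 ∅ ∅ ∅) ∅) (branch 109 ∅ ∅ ∅) ∅) ∅) (branch 89
  (branch 89 ∅ (branch 111 ∅ ∅ ∅) ∅) (branch 109 ∅ ∅ ∅) ∅) ∅) ∅) (branch 69 (branch 69 (branch 69 (branch 69
  ∅ (branch 89 ∅ ∅ ∅) ∅) (branch 89 (branch 89 ∅ (branch 111 ∅ ∅ ∅) ∅) (branch 109 ∅ ∅ ∅) ∅) ∅) (branch 89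
  (branch 89 (branch 89 ∅ (branch 111 ∅ ∅ ∅) ∅) (branch 111 (branch 111 ∅ (branch 136 ∅ ∅ ∅) ∅) (branch 131 ∅
  ∅ ∅) ∅) ∅) (branch 109 (branch 111 ∅ (branch 136 ∅ ∅ ∅) ∅) (branch 131 ∅ ∅ ∅) ∅) ∅) ∅) (branch 89 (branch
  89 (branch 89 ∅ (branch 111 ∅ ∅ ∅) ∅) (branch 111 (branch 111 ∅ (branch 136 ∅ ∅ ∅) ∅) (branch 131 ∅ ∅ ∅) ∅)
  ∅) (branch 109 (branch 111 ∅ (branch 136 ∅ ∅ ∅) ∅) (branch 131 ∅ ∅ ∅) ∅) ∅) ∅) ∅) (branch 64 (branch 69
  (branch 69 (branch 69 ∅ (branch 89 ∅ ∅ ∅) ∅) (branch 89 (branch 89 ∅ (branch 109 ∅ ∅ ∅) ∅) (branch 109 ∅ ∅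
  ∅) ∅) ∅) (branch 89 (branch 89 (branch 89 ∅ (branch 109 ∅ ∅ ∅) ∅) (branch 109 (branch 109 ∅ (branch 134 ∅ ∅
  ∅) ∅) (branch 131 ∅ ∅ ∅) ∅) ∅) (branch 109 (branch 109 ∅ (branch 134 ∅ ∅ ∅) ∅) (branch 131 ∅ ∅ ∅) ∅) ∅) ∅)
  (branch 84 (branch 89 (branch 89 ∅ (branch 109 ∅ ∅ ∅) ∅) (branch 109 (branch 109 ∅ (branch 131 ∅ ∅ ∅) ∅)
  (branch 131 ∅ ∅ ∅) ∅) ∅) (branch 104 (branch 109 ∅ (branch 131 ∅ ∅ ∅) ∅) (branch 126 ∅ ∅ ∅) ∅) ∅) ∅) ∅) ∅)
  ∅) ∅))

bound : List ℕ → ℕ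
bound = look bounds

bound-lowerBound : LowerBound bound
bound-lowerBound = certified⇒lowerBound bound certified-everywhere
  where
  certified-everywhere : ∀ W → T (certified bound W)
  certified-everywhere W with everywhere-sound (certified bound) bounds [] _ W
  ... | inj₁ bound≡0 = certified-zero bound {W} bound≡0
  ... | inj₂ ok      = ok

module _ {A : Set} where

  combinations : ℕ → List A → List (List A)
  combinations zero    _        = [] ∷ []
  combinations (suc k) []       = []
  combinations (suc k) (x ∷ xs) = map (x ∷_) (combinations k xs) ++ combinations (suc k) xs

  ⊆⇒∈-combinations : ∀ {xs ys : List A} → xs ⊆ ys → xs ∈ combinations (length xs) ys
  ⊆⇒∈-combinations []                     = here refl
  ⊆⇒∈-combinations {[]}     (_ ∷ʳ _)      = here refl
  ⊆⇒∈-combinations {_ ∷ _} (_ ∷ʳ xs⊆ys)   = ∈-++⁺ʳ _ (⊆⇒∈-combinations xs⊆ys)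
  ⊆⇒∈-combinations (refl ∷ xs⊆ys)         = ∈-++⁺ˡ (∈-map⁺ _ (⊆⇒∈-combinations xs⊆ys))

selection-↭ : ∀ {S J} → Unique S → All (_∈ J) S → Unique J → S ↭ filter (_∈? S) J
selection-↭ {S} {J} unique-S S⊆J unique-J =
  ∼bag⇒↭ (unique∧set⇒bag unique-S (filter⁺ (_∈? S) unique-J) (mk⇔ into (proj₂ ∘ ∈-filter⁻ (_∈? S) {xs = J})))
  where
  into : ∀ {v} → v ∈ S → v ∈ filter (_∈? S) J
  into v∈S = ∈-filter⁺ (_∈? S) (All.lookup S⊆J v∈S) v∈S

locates? : ∀ L t → Dec (Locates L t)
locates? L t =
  map′ (λ found _ → All.lookup found) (λ loc → All.tabulate (loc _)) (all? (λ v → search v t ≟ v) L)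

admissible? : ∀ J h S → Dec (Admissible J h S)
admissible? J h S = unique? S ×-dec all? (_∈? J) S ×-dec length S + h ≟ length J

correct? : ∀ S t → Dec (Correct S t)
correct? S t =
  unique? (leaves t) ×-dec all? (_∈? S) (leaves t) ×-dec length (leaves t) ≟ length S ×-dec locates? S t

I-increasing : ∀ ℓ → AllPairs _<_ (I ℓ)
I-increasing ℓ = applyUpTo⁺₁ suc ℓ (λ i<j _ → s≤s i<j)

forcing : List ℕ → Bool
forcing L = (69 ≤ᵇ bound (map p L)) ∧ ((weight L ≡ᵇ 27) ∨ (70 ≤ᵇ bound (map p L)))

forcing-cost : ∀ ℓ h {S t} → T (all forcing (combinations (ℓ ∸ h) (I ℓ))) →
  Admissible (I ℓ) h S → Locates S t → 69 ≤ cost S t × (weight S ≡ 27 ⊎ 70 ≤ cost S t)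
forcing-cost ℓ h {S} {t} all-forcing (unique-S , S⊆I , |S|+h≡ℓ) loc =
  ≤-trans (≤ᵇ⇒≤ 69 _ at-least-69) lower ,
  Sum.map (λ is-27 → trans weight-S≡L (≡ᵇ⇒≡ _ 27 is-27)) (λ at-least-70 → ≤-trans (≤ᵇ⇒≤ 70 _ at-least-70) lower)
          (Equivalence.to T-∨ weight-27-or-70)
  where
  L = filter (_∈? S) (I ℓ)
  S↭L : S ↭ L
  S↭L = selection-↭ unique-S S⊆I (AllPairs.map <⇒≢ (I-increasing ℓ))
  |L| : length L ≡ ℓ ∸ h
  |L| = begin
    length L          ≡⟨ ↭-length S↭L ⟨
    length S          ≡⟨ m+n∸n≡m (length S) h ⟨
    length S + h ∸ h  ≡⟨ cong (_∸ h) (trans |S|+h≡ℓ (length-applyUpTo suc ℓ)) ⟩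
    ℓ ∸ h             ∎
    where open ≡-Reasoning
  L-forcing : T (forcing L)
  L-forcing = All.lookup (all⁺ forcing _ all-forcing)
    (subst (λ n → L ∈ combinations n (I ℓ)) |L| (⊆⇒∈-combinations (filter-⊆ (_∈? S) (I ℓ))))
  at-least-69 : T (69 ≤ᵇ bound (map p L))
  at-least-69 = proj₁ (Equivalence.to T-∧ L-forcing)
  weight-27-or-70 : T ((weight L ≡ᵇ 27) ∨ (70 ≤ᵇ bound (map p L)))
  weight-27-or-70 = proj₂ (Equivalence.to T-∧ L-forcing)
  lower : bound (map p L) ≤ cost S t
  lower = subst (bound (map p L) ≤_) (sym (sum-↭ (map⁺ (λ v → p v * depth v t) S↭L)))
    (cost-lowerBound bound-lowerBound t (filter⁺ (_∈? S) (I-increasing ℓ))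
                     (λ v v∈L → loc v (proj₂ (∈-filter⁻ (_∈? S) {xs = I ℓ} v∈L))))
  weight-S≡L : weight S ≡ weight L
  weight-S≡L = sum-↭ (map⁺ p S↭L)

witnessed-optimum : ∀ ℓ h t
  {_ : True (admissible? (I ℓ) h (leaves t))} {_ : True (correct? (leaves t) t)}
  {_ : T (cost (leaves t) t ≡ᵇ 69)} {_ : T (all forcing (combinations (ℓ ∸ h) (I ℓ)))} →
  ∀ S t′ → Optimal (I ℓ) h S t′ → weight S ≡ 27 × cost S t′ ≡ 69
witnessed-optimum ℓ h t {admissible-t} {correct-t} {cost-t} {all-forcing} S t′
                  (admissible , (_ , _ , _ , loc) , minimal)
  with at-least-69 , weight-27-or-70 ← forcing-cost ℓ h all-forcing admissible loc =
  Sum.[ id , (λ at-least-70 → contradiction (≤-trans at-least-70 upper) (1+n≰n {69})) ] weight-27-or-70 ,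
  ≤-antisym upper at-least-69
  where
  upper : cost S t′ ≤ 69
  upper = subst (cost S t′ ≤_) (≡ᵇ⇒≡ _ 69 cost-t)
                (minimal (leaves t) t (toWitness admissible-t) (toWitness correct-t))

tree₈ tree₉ tree₁₁ tree₁₃ : Tree
tree₈ = node ltOp 3 (node ltOp 2 (leaf 1) (leaf 2))
          (node ltOp 8 (node eqOp 4 (leaf 4) (node eqOp 6 (leaf 6)
                         (node ltOp 5 (leaf 3) (node ltOp 7 (leaf 5) (leaf 7)))))
                       (leaf 8))
tree₉ = node ltOp 3 (node ltOp 2 (leaf 1) (leaf 2))
          (node eqOp 4 (leaf 4) (node eqOp 6 (leaf 6) (node eqOp 8 (leaf 8)
            (node ltOp 5 (leaf 3) (node ltOp 7 (leaf 5) (node ltOp 9 (leaf 7) (leaf 9)))))))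
tree₁₁ = node ltOp 3 (node ltOp 2 (leaf 1) (leaf 2))
           (node eqOp 4 (leaf 4) (node eqOp 6 (leaf 6) (node eqOp 8 (leaf 8)
             (node ltOp 5 (leaf 3) (node ltOp 7 (leaf 5) (node ltOp 9 (leaf 7)
               (node ltOp 11 (leaf 9) (leaf 11))))))))
tree₁₃ = node ltOp 3 (node ltOp 2 (leaf 1) (leaf 2))
           (node eqOp 4 (leaf 4) (node eqOp 6 (leaf 6) (node eqOp 8 (leaf 8)
             (node ltOp 5 (leaf 3) (node ltOp 7 (leaf 5) (node ltOp 9 (leaf 7)
               (node ltOp 11 (leaf 9) (node ltOp 13 (leaf 11) (leaf 13)))))))))

optimum-by-length : ∀ ℓ h → ℓ ≤ 14 → q ℓ ≡ 5 + h →
  ∀ S t → Optimal (I ℓ) h S t → weight S ≡ 27 × cost S t ≡ 69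
optimum-by-length 8  .0 _ refl = witnessed-optimum 8  0 tree₈
optimum-by-length 9  .0 _ refl = witnessed-optimum 9  0 tree₉
optimum-by-length 10 .1 _ refl = witnessed-optimum 10 1 tree₉
optimum-by-length 11 .1 _ refl = witnessed-optimum 11 1 tree₁₁
optimum-by-length 12 .2 _ refl = witnessed-optimum 12 2 tree₁₁
optimum-by-length 13 .2 _ refl = witnessed-optimum 13 2 tree₁₃
optimum-by-length 14 .3 _ refl = witnessed-optimum 14 3 tree₁₃
optimum-by-length 0 _ _ ()
optimum-by-length 1 _ _ ()
optimum-by-length 2 _ _ ()
optimum-by-length 3 _ _ ()
optimum-by-length 4 _ _ ()
optimum-by-length 5 _ _ ()
optimum-by-length 6 _ _ ()
optimum-by-length 7 _ _ ()
optimum-by-length (suc (suc (suc (suc (suc (suc (suc (suc (suc (suc (suc (suc (suc (suc (suc _))))))))))))))) _ ℓ≤14 _ =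
  contradiction ℓ≤14 (<⇒≱ (m≤m+n 15 _))

lemma4 : (ℓ h′ : ℕ) → 1 ≤ ℓ → ℓ ≤ 14 → q ℓ ≡ h′ + 5 →
    (S : List ℕ) (T : Tree) → Optimal (I ℓ) h′ S T →
    weight S ≡ 27 × cost S T ≡ 69
lemma4 ℓ h′ _ ℓ≤14 q≡h′+5 = optimum-by-length ℓ h′ ℓ≤14 (trans q≡h′+5 (+-comm h′ 5))
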